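{- Let $a, m, k \in \mathbb{N}$ with $k > a$. Then $$\{ \alpha < \mathrm{tow}_{k}(\varepsilon_{m}) : \mathrm{psn}(\alpha)\leq a\} = \{ \alpha < \mathrm{tow}_{a}(\varepsilon_{m}) : \mathrm{psn}(\alpha)\leq a\}.$$
   Context: All ordinals are below $\varepsilon_\omega$, and $\varepsilon_{ -1}$ denotes $\omega$. $\mathrm{tow}_n(\beta)$ is the ordinal tower of exponentials: $\mathrm{tow}_0(\beta)=1$ and $\mathrm{tow}_{n+1}(\beta)=\beta^{\mathrm{tow}_n(\beta)}$. For $\alpha<\varepsilon_\omega$ put $l(\alpha)=\min\{n\in\mathbb{N}:\alpha<\varepsilon_n\}$ and $h(\alpha)=\min\{n\in\mathbb{N}:\alpha<\mathrm{tow}_n(\varepsilon_{l(\alpha)-1})\}$. The normal form of $\alpha$ is $$\alpha=\varepsilon_{m}^{\alpha_{0}}\cdot\xi_{0}+\ldots+\varepsilon_{m}^{\alpha_{s}}\cdot\xi_{s}$$ with $m=l(\alpha)-1$, $\alpha_0>\ldots>\alpha_s$ and $0<\xi_i<\varepsilon_m$. The pseudonorm is defined by $$\mathrm{psn}(\alpha)=\max\{h(\alpha),\mathrm{psn}(\alpha_0),\ldots,\mathrm{psn}(\alpha_s),\mathrm{psn}(\xi_0),\ldots,\mathrm{psn}(\xi_s)\}\quad\text{if }\alpha\ge\omega,$$ and $\mathrm{psn}(\alpha)=\alpha$ if $\alpha<\omega$. In the paper's notation the two sets are $N^m_k(a)$ and $N^m_a(a)$, where $N^m_k(a)=\{\alpha<\mathrm{tow}_k(\varepsilon_m):\mathrm{psn}(\alpha)\le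 a\}$. -}

module Defs where

open import Data.Nat using (ℕ; zero; suc; _+_; _≤_; _<ᵇ_; _⊔_)
open import Data.Bool using (Bool; true; false; if_then_else_)
open import Data.List using (List; []; _∷_)
open import Data.Product using (_×_; _,_)
open import Data.Unit using (⊤)
open import Data.Empty using (⊥)
open import Relation.Binary.PropositionalEquality using (_≡_)

-- Ordinal notations for ordinals below ε_ω, following the paper's normal form.
--   fin n       : the finite ordinal n
--   lv i xs     : an ordinal α with l(α) = i (so ε_{i-1} ≤ α < ε_i, where ε_{-1} = ω),
--                 written in base b_i = ε_{i-1} as
--                 b_i^{e₀}·c₀ + … + b_i^{eₛ}·cₛ   for xs = (e₀ , c₀) ∷ … ∷ (eₛ , cₛ) ∷ []
data O : Set where
  fin : ℕ → O
  lv  : ℕ → List (O × O) → O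

data Cmp : Set where
  lt eq gt : Cmp

cmpℕ : ℕ → ℕ → Cmp
cmpℕ m n = if m <ᵇ n then lt else (if n <ᵇ m then gt else eq)

mutual
  cmp : O → O → Cmp
  cmp (fin m) (fin n) = cmpℕ m n
  cmp (fin _) (lv _ _) = lt
  cmp (lv _ _) (fin _) = gt
  cmp (lv i xs) (lv j ys) with cmpℕ i j
  ... | lt = lt
  ... | gt = gt
  ... | eq = cmpL xs ys

  cmpL : List (O × O) → List (O × O) → Cmp
  cmpL [] [] = eq
  cmpL [] (_ ∷ _) = lt
  cmpL (_ ∷ _) [] = gt
  cmpL ((e , c) ∷ xs) ((f , d) ∷ ys) with cmp e f
  ... | lt = lt
  ... | gt = gt
  ... | eq with cmp c d
  ...   | lt = lt
  ...   | gt = gt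
  ...   | eq = cmpL xs ys

infix 4 _<ₒ_
_<ₒ_ : O → O → Set
α <ₒ β = cmp α β ≡ lt

level : O → ℕ
level (fin _) = zero
level (lv i _) = i

IsFin : O → Set
IsFin (fin _) = ⊤
IsFin (lv _ _) = ⊥

-- coefficient bound ξ < b_i  (b_0 = ω, b_{j+1} = ε_j)
CoefOK : ℕ → O → Set
CoefOK zero c = IsFin c
CoefOK (suc j) c = level c ≤ j

LeadOK : List (O × O) → Set
LeadOK [] = ⊥
LeadOK ((e , _) ∷ _) = fin 0 <ₒ e

Decr : O → List (O × O) → Set
Decr e [] = ⊤
Decr e ((f , _) ∷ _) = f <ₒ e

mutual
  WF : O → Set
  WF (fin _) = ⊤
  WF (lv i xs) = LeadOK xs × WFterms i xs

  WFterms : ℕ → List (O × O) → Set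
  WFterms i [] = ⊤
  WFterms i ((e , c) ∷ xs) =
    WF e × level e ≤ i × WF c × fin 0 <ₒ c × CoefOK i c × Decr e xs × WFterms i xs

-- tow n i = tow_n(b_i), where b_0 = ω and b_{i+1} = ε_i
tow : ℕ → ℕ → O
tow zero i = fin 1
tow (suc n) i = lv i ((tow n i , fin 1) ∷ [])

mutual
  size : O → ℕ
  size (fin _) = 1
  size (lv _ xs) = suc (sizeL xs)

  sizeL : List (O × O) → ℕ
  sizeL [] = 0
  sizeL ((e , c) ∷ xs) = size e + size c + sizeL xs

isLt : Cmp → Bool
isLt lt = true
isLt _ = false

hsearch : O → ℕ → ℕ → ℕ → ℕ
hsearch α i n zero = n
hsearch α i n (suc fuel) = if isLt (cmp α (tow n i)) then n else hsearch α i (suc n) fuel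

-- h(α) = min { n : α < tow_n(ε_{l(α)-1}) }   (fuel size α + 2 always suffices)
h : O → ℕ
h α = hsearch α (level α) 0 (size α + 2)

mutual
  psn : O → ℕ
  psn (fin n) = n
  psn (lv i xs) = h (lv i xs) ⊔ psnL xs

  psnL : List (O × O) → ℕ
  psnL [] = 0
  psnL ((e , c) ∷ xs) = psn e ⊔ psn c ⊔ psnL xs

module Submission where

-- Write b_i for the base ε_{i-1} (b_0 = ω), so that
-- tow n i = tow_n(b_i).  The theorem says that a well-formed notation α with
-- psn(α) ≤ a lies below tow_k(b_{m+1}), where k > a, iff it lies below
-- tow_a(b_{m+1}).  Right to left is monotonicity of towers in the height.
-- Left to right rests on one bound: every well-formed α lies below
-- tow_{psn α}(b_{l(α)}).  Since h(α) ≤ psn(α), it suffices to know that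
-- α < tow_{h α}(b_{l(α)}); h is computed by a bounded search, so this needs
-- a witness height within the search range, and size α is such a witness.
-- Finally, α < tow_k(b_i) forces l(α) ≤ i, and when l(α) < i the notation α
-- lies below every nontrivial tower over b_i anyway.

open import Data.Nat using (ℕ; zero; suc; _≤_; _<_; _+_; z≤n; s≤s)
open import Data.Nat.Properties
  using (<-cmp; ≤-refl; ≤-trans; ≤-reflexive; <⇒≤; m≤m+n; m≤m⊔n; m≤n⇒m<n∨m≡n; +-identityʳ; +-suc)
open import Data.Product using (_×_; _,_)
open import Data.Sum using (inj₁; inj₂)
open import Data.List using ([]; _∷_)
open import Data.Empty using (⊥; ⊥-elim)
open import Function.Bundles using (_⇔_; mk⇔)
open import Relation.Binary using (tri<; tri≈; tri>)
open import Relation.Binary.PropositionalEquality using (_≡_; refl; sym; trans; subst)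
open import Defs

cmpℕ-refl : ∀ n → cmpℕ n n ≡ eq
cmpℕ-refl zero = refl
cmpℕ-refl (suc n) = cmpℕ-refl n

cmpℕ-lt : ∀ {j i} → j < i → cmpℕ j i ≡ lt
cmpℕ-lt {zero} {suc i} _ = refl
cmpℕ-lt {suc j} {suc i} (s≤s j<i) = cmpℕ-lt j<i

cmpℕ-gt : ∀ {j i} → i < j → cmpℕ j i ≡ gt
cmpℕ-gt {suc j} {zero} _ = refl
cmpℕ-gt {suc j} {suc i} (s≤s i<j) = cmpℕ-gt i<j

cmp-lv-lt : ∀ {j i} xs ys → j < i → cmp (lv j xs) (lv i ys) ≡ lt
cmp-lv-lt xs ys j<i rewrite cmpℕ-lt j<i = refl

cmp-lv-gt : ∀ {j i} xs ys → i < j → cmp (lv j xs) (lv i ys) ≡ gt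
cmp-lv-gt xs ys i<j rewrite cmpℕ-gt i<j = refl

cmp-lv-eq : ∀ i xs ys → cmp (lv i xs) (lv i ys) ≡ cmpL xs ys
cmp-lv-eq i xs ys rewrite cmpℕ-refl i = refl

lowerLevel-below-tow : ∀ α {i} n → level α < i → α <ₒ tow (suc n) i
lowerLevel-below-tow (fin _) n _ = refl
lowerLevel-below-tow (lv j xs) n j<i = cmp-lv-lt xs _ j<i

level-below-tow : ∀ α i n → α <ₒ tow n i → level α ≤ i
level-below-tow (fin _) i n _ = z≤n
level-below-tow (lv j xs) i zero ()
level-below-tow (lv j xs) i (suc n) α<tow with <-cmp j i
... | tri< j<i _ _ = <⇒≤ j<i
... | tri≈ _ j≡i _ = ≤-reflexive j≡i
... | tri> _ _ i<j with () ← trans (sym (cmp-lv-gt xs _ i<j)) α<tow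

leadingExponent-below⇒below-tow :
  ∀ i n e c xs → e <ₒ tow n i → lv i ((e , c) ∷ xs) <ₒ tow (suc n) i
leadingExponent-below⇒below-tow i n e c xs e<tow
  rewrite cmp-lv-eq i ((e , c) ∷ xs) ((tow n i , fin 1) ∷ []) | e<tow = refl

positive-not-below-1 : ∀ c → fin 0 <ₒ c → c <ₒ fin 1 → ⊥
positive-not-below-1 (fin zero) () _
positive-not-below-1 (fin (suc zero)) _ ()
positive-not-below-1 (fin (suc (suc _))) _ ()
positive-not-below-1 (lv _ _) _ ()

-- Conversely, since the leading coefficient is at least 1, the notation can
-- only lie below the monomial tow_{n+1}(b_i) = b_i^{tow_n(b_i)} if its leading
-- exponent is strictly smaller.
below-tow⇒leadingExponent-below : ∀ i n e c xs → fin 0 <ₒ c →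
  lv i ((e , c) ∷ xs) <ₒ tow (suc n) i → e <ₒ tow n i
below-tow⇒leadingExponent-below i n e c xs c>0 α<tow
  rewrite cmp-lv-eq i ((e , c) ∷ xs) ((tow n i , fin 1) ∷ []) with cmp e (tow n i)
... | lt = refl
... | gt with () ← α<tow
... | eq with cmp c (fin 1) in c-vs-1
...   | lt = ⊥-elim (positive-not-below-1 c c>0 c-vs-1)
...   | gt with () ← α<tow
...   | eq with xs | α<tow
...     | [] | ()
...     | _ ∷ _ | ()

tow-mono : ∀ α i s t → WF α → s ≤ t → α <ₒ tow s i → α <ₒ tow t i
tow-mono α i zero zero _ _ α<tow = α<tow
tow-mono (fin _) i zero (suc t) _ _ _ = refl
tow-mono (lv _ _) i zero (suc t) _ _ ()
tow-mono (fin _) i (suc s) (suc t) _ _ _ = refl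
tow-mono (lv j xs) i (suc s) (suc t) wf s≤t α<tow
  with m≤n⇒m<n∨m≡n (level-below-tow (lv j xs) i (suc s) α<tow)
... | inj₁ j<i = lowerLevel-below-tow (lv j xs) t j<i
tow-mono (lv j []) i (suc s) (suc t) (() , _) s≤t α<tow | inj₂ refl
tow-mono (lv j ((e , c) ∷ xs)) i (suc s) (suc t) (_ , wfe , _ , _ , c>0 , _) (s≤s s≤t) α<tow
  | inj₂ refl =
  leadingExponent-below⇒below-tow j t e c xs
    (tow-mono e j s t wfe s≤t (below-tow⇒leadingExponent-below j s e c xs c>0 α<tow))

-- Every well-formed notation of level ≤ i lies below tow_{size α}(b_i); this is
-- the witness height that makes the bounded search defining h succeed.
below-tow-size : ∀ α i → WF α → level α ≤ i → α <ₒ tow (size α) i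
below-tow-size (fin _) i _ _ = refl
below-tow-size (lv j xs) i wf j≤i with m≤n⇒m<n∨m≡n j≤i
... | inj₁ j<i = lowerLevel-below-tow (lv j xs) (sizeL xs) j<i
below-tow-size (lv j []) i (() , _) j≤i | inj₂ refl
below-tow-size (lv j ((e , c) ∷ xs)) i (_ , wfe , e≤j , _) j≤i | inj₂ refl =
  leadingExponent-below⇒below-tow j (sizeL ((e , c) ∷ xs)) e c xs
    (tow-mono e j (size e) (size e + size c + sizeL xs) wfe
      (≤-trans (m≤m+n (size e) (size c)) (m≤m+n _ _))
      (below-tow-size e j wfe e≤j))

hsearch-correct : ∀ α i n fuel s → WF α → s ≤ n + fuel →
  α <ₒ tow s i → α <ₒ tow (hsearch α i n fuel) i
hsearch-correct α i n zero s wf s≤n α<tow =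
  tow-mono α i s n wf (subst (s ≤_) (+-identityʳ n) s≤n) α<tow
hsearch-correct α i n (suc fuel) s wf s≤bound α<tow with cmp α (tow n i) in α-vs-tow
... | lt = α-vs-tow
... | eq = hsearch-correct α i (suc n) fuel s wf (subst (s ≤_) (+-suc n fuel) s≤bound) α<tow
... | gt = hsearch-correct α i (suc n) fuel s wf (subst (s ≤_) (+-suc n fuel) s≤bound) α<tow

below-tow-h : ∀ α → WF α → α <ₒ tow (h α) (level α)
below-tow-h α wf =
  hsearch-correct α (level α) 0 (size α + 2) (size α) wf (m≤m+n (size α) 2)
    (below-tow-size α (level α) wf ≤-refl)

below-tow-psn : ∀ α → WF α → α <ₒ tow (psn α) (level α)
below-tow-psn (fin zero) _ = refl
below-tow-psn (fin (suc _)) _ = refl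
below-tow-psn (lv j xs) wf =
  tow-mono (lv j xs) j (h (lv j xs)) (psn (lv j xs)) wf (m≤m⊔n _ _) (below-tow-h (lv j xs) wf)

-- Hence a notation of level ≤ i with psn α ≤ a lies below tow_a(b_i).
-- (For a = 0 the tower tow_0 = 1 does not depend on the base.)
below-tow-of-psn≤ : ∀ α i a → WF α → level α ≤ i → psn α ≤ a → α <ₒ tow a i
below-tow-of-psn≤ α i zero wf _ psn≤0 =
  tow-mono α (level α) (psn α) zero wf psn≤0 (below-tow-psn α wf)
below-tow-of-psn≤ α i (suc a) wf l≤i psn≤a with m≤n⇒m<n∨m≡n l≤i
... | inj₁ l<i = lowerLevel-below-tow α a l<i
... | inj₂ refl = tow-mono α (level α) (psn α) (suc a) wf psn≤a (below-tow-psn α wf)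

mainTheorem4 : (a m k : ℕ) → a < k → (α : O) → WF α →
    ((α <ₒ tow k (suc m)) × psn α ≤ a) ⇔ ((α <ₒ tow a (suc m)) × psn α ≤ a)
mainTheorem4 a m k a<k α wf = mk⇔ shrink grow
  where
  shrink : (α <ₒ tow k (suc m)) × psn α ≤ a → (α <ₒ tow a (suc m)) × psn α ≤ a
  shrink (α<tow , psn≤a) =
    below-tow-of-psn≤ α (suc m) a wf (level-below-tow α (suc m) k α<tow) psn≤a , psn≤a

  grow : (α <ₒ tow a (suc m)) × psn α ≤ a → (α <ₒ tow k (suc m)) × psn α ≤ a
  grow (α<tow , psn≤a) = tow-mono α (suc m) a k wf (<⇒≤ a<k) α<tow , psn≤a
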